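{- Let $n\ge 1$. For every partition $\lambda$ of $n$ other than $(n)$ and $(1,1,\dots,1)$, there exists a cyclic permutation $\sigma$ of $\{1,\dots,n\}$ (i.e. a permutation whose cycle decomposition consists of a single $n$-cycle) such that $\Gamma(P(\sigma))=\lambda$.
   Context: Permutations of $\{1,\dots,n\}$ are written as sequences $\sigma=(\sigma_1,\dots,\sigma_n)$ with $\sigma_i$ the image of $i$. For a finite sequence $\sigma$ of distinct integers, $P(\sigma)$ is the Robinson--Schensted--Knuth insertion tableau: starting from the empty tableau, the entries $\sigma_1,\sigma_2,\dots$ are inserted in order by row insertion (to insert $a$ into row $r$: if row $r$ is empty or $a$ exceeds every entry of row $r$, append $a$ at the end of row $r$ and stop; otherwise replace the leftmost entry $b>a$ of row $r$ by $a$ and insert $b$ into row $r+1$). $\Gamma(P(\sigma))$ denotes the shape of $P(\sigma)$, i.e. its list of row lengths in nonincreasing order (a partition of the length of $\sigma$). -}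

module Defs where

open import Data.Nat using (ℕ; zero; suc; _+_; _≥_; _<ᵇ_)
open import Data.Bool using (if_then_else_)
open import Data.Fin using (Fin; toℕ)
open import Data.Fin.Permutation using (Permutation′; _⟨$⟩ʳ_)
open import Data.List using (List; []; _∷_; map; length; foldl; allFin)
open import Data.Nat.ListAction using (sum)
open import Data.List.Relation.Unary.All using (All)
open import Data.List.Relation.Unary.Linked using (Linked)
open import Data.Maybe using (Maybe; just; nothing)
open import Data.Product using (_×_; _,_; ∃)
open import Relation.Binary.PropositionalEquality using (_≡_)

-- A Young tableau is stored as its list of rows (top row first).
Tableau : Set
Tableau = List (List ℕ)

insertRow : ℕ → List ℕ → List ℕ × Maybe ℕ
insertRow a [] = a ∷ [] , nothing
insertRow a (b ∷ bs) with a <ᵇ b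
... | Data.Bool.true  = a ∷ bs , just b
... | Data.Bool.false with insertRow a bs
...   | bs' , m = b ∷ bs' , m

insertT : ℕ → Tableau → Tableau
insertT a [] = (a ∷ []) ∷ []
insertT a (r ∷ rs) with insertRow a r
... | r' , nothing = r' ∷ rs
... | r' , just b  = r' ∷ insertT b rs

P : List ℕ → Tableau
P σ = foldl (λ T a → insertT a T) [] σ

Γ : Tableau → List ℕ
Γ T = map length T

IsPartition : ℕ → List ℕ → Set
IsPartition n λ′ = All (λ k → k ≥ 1) λ′ × Linked _≥_ λ′ × sum λ′ ≡ n

-- The permutation σ of {1,…,n} written as the sequence (σ 1, …, σ n),
-- with Fin n = {0,…,n-1} shifted to {1,…,n}.
oneLine : ∀ {n} → Permutation′ n → List ℕ
oneLine {n} π = map (λ i → suc (toℕ (π ⟨$⟩ʳ i))) (allFin n)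

iter : ∀ {n} → Permutation′ n → ℕ → Fin n → Fin n
iter π zero    i = i
iter π (suc k) i = π ⟨$⟩ʳ iter π k i

IsCyclic : ∀ {n} → Permutation′ n → Set
IsCyclic {n} π = ∀ (i j : Fin n) → ∃ λ k → iter π k i ≡ j

-- Let c₁ ≥ c₂ ≥ ⋯ be the column lengths of λ; excluding (n) and (1ⁿ) means c₁ ≥ 2 and c₂ ≥ 1.
-- The word is built one column at a time, column j taking the next interval of values.  On
-- that interval its letters form two decreasing runs around one letter from another column,
-- so every row insertion just starts or lengthens a column of a tableau whose columns are
-- intervals: the insertion tableau has the intervals as columns, hence shape λ.  As a
-- permutation, the new positions form a zigzag through the interval, which is spliced into
-- the cycle through 1 right after the previous maximum, so that cycle keeps every point.

module Submission where

open import Defs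
open import Data.Bool using (true; false; T)
open import Data.Empty using (⊥-elim)
open import Data.Fin using (Fin; toℕ; fromℕ<)
open import Data.Fin.Permutation using (Permutation′; permutation; _⟨$⟩ʳ_) renaming (id to idₚ)
open import Data.Fin.Properties using (toℕ-fromℕ<; toℕ-injective; toℕ<n)
open import Data.List using (List; []; _∷_; _++_; map; length; foldl; replicate; applyUpTo; tabulate; allFin)
open import Data.List.Properties using (++-assoc; ++-identityʳ; length-++; map-++; foldl-++; map-cong; map-tabulate)
open import Data.List.Membership.Propositional using (_∈_)
open import Data.List.Membership.Propositional.Properties using (∈-++⁺ˡ; ∈-++⁺ʳ; ∈-++⁻)
open import Data.List.Relation.Unary.All as All using (All; []; _∷_)
import Data.List.Relation.Unary.All.Properties as All
open import Data.List.Relation.Unary.Any using (here; there)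
open import Data.List.Relation.Unary.Linked using (Linked; []; _∷_)
import Data.List.Relation.Unary.Linked.Properties as Linked
open import Data.Maybe using (Maybe; just; nothing)
open import Data.Nat
open import Data.Nat.GeneralisedArithmetic using (fold; fold-+)
open import Data.Nat.ListAction using (sum)
open import Data.Nat.Properties
open import Data.Product using (Σ; ∃; _×_; _,_; proj₁; proj₂)
open import Data.Sum using (_⊎_; inj₁; inj₂)
open import Data.Unit using (⊤; tt)
open import Relation.Binary.PropositionalEquality
open ≡-Reasoning

m<n⇒m<ᵇn≡true : ∀ {m n} → m < n → (m <ᵇ n) ≡ true
m<n⇒m<ᵇn≡true {m} {n} m<n with m <ᵇ n in eq
... | true  = refl
... | false = ⊥-elim (subst T eq (<⇒<ᵇ m<n))

n≤m⇒m<ᵇn≡false : ∀ {m n} → n ≤ m → (m <ᵇ n) ≡ false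
n≤m⇒m<ᵇn≡false {m} {n} n≤m with m <ᵇ n in eq
... | false = refl
... | true  = ⊥-elim (<⇒≱ (<ᵇ⇒< m n (subst T (sym eq) tt)) n≤m)

insertRow-++ : ∀ a xs ys → All (_≤ a) xs →
  insertRow a (xs ++ ys) ≡ (xs ++ proj₁ (insertRow a ys) , proj₂ (insertRow a ys))
insertRow-++ a []       ys []           = refl
insertRow-++ a (x ∷ xs) ys (x≤a ∷ xs≤a)
  rewrite n≤m⇒m<ᵇn≡false x≤a | insertRow-++ a xs ys xs≤a = refl

insertT-bump : ∀ a r rs {b r′} → insertRow a r ≡ (r′ , just b) → insertT a (r ∷ rs) ≡ r′ ∷ insertT b rs
insertT-bump a r rs eq rewrite eq = refl

insertT-settle : ∀ a r rs {r′} → insertRow a r ≡ (r′ , nothing) → insertT a (r ∷ rs) ≡ r′ ∷ rs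
insertT-settle a r rs eq rewrite eq = refl

-- Row insertion into tableaux whose columns are intervals

-- A column (t , k) holds t, t+1, …, t+k-1, and row i
-- lists t + i for the leading columns longer than i.
Column : Set
Column = ℕ × ℕ

row : ℕ → List Column → List ℕ
row i []             = []
row i ((t , k) ∷ cs) with i <ᵇ k
... | true  = t + i ∷ row i cs
... | false = []

rowsFrom : ℕ → ℕ → List Column → Tableau
rowsFrom i zero    cs = []
rowsFrom i (suc h) cs = row i cs ∷ rowsFrom (suc i) h cs

height : List Column → ℕ
height []            = 0
height ((_ , k) ∷ _) = k

columnTableau : List Column → Tableau
columnTableau cs = rowsFrom 0 (height cs) cs

row-++ : ∀ i cs ds → All (λ c → i < proj₂ c) cs → row i (cs ++ ds) ≡ row i cs ++ row i ds
row-++ i []             ds []           = refl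
row-++ i ((t , k) ∷ cs) ds (i<k ∷ i<cs)
  rewrite m<n⇒m<ᵇn≡true i<k = cong (t + i ∷_) (row-++ i cs ds i<cs)

row-short : ∀ i ds → height ds ≤ i → row i ds ≡ []
row-short i []             _   = refl
row-short i ((t , k) ∷ ds) k≤i rewrite n≤m⇒m<ᵇn≡false k≤i = refl

row-cut : ∀ i cs ds → height ds ≤ i → row i (cs ++ ds) ≡ row i cs
row-cut i []             ds ds≤i = row-short i ds ds≤i
row-cut i ((t , k) ∷ cs) ds ds≤i with i <ᵇ k
... | true  = cong (t + i ∷_) (row-cut i cs ds ds≤i)
... | false = refl

rowsFrom-cut : ∀ i h cs ds → height ds ≤ i → rowsFrom i h (cs ++ ds) ≡ rowsFrom i h cs
rowsFrom-cut i zero    cs ds ds≤i = refl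
rowsFrom-cut i (suc h) cs ds ds≤i =
  cong₂ _∷_ (row-cut i cs ds ds≤i) (rowsFrom-cut (suc i) h cs ds (m≤n⇒m≤1+n ds≤i))

row-bounded : ∀ x i cs → All (λ c → proj₁ c ≤ x) cs → All (_≤ x + i) (row i cs)
row-bounded x i []             []           = []
row-bounded x i ((t , k) ∷ cs) (t≤x ∷ cs≤x) with i <ᵇ k
... | true  = +-monoˡ-≤ i t≤x ∷ row-bounded x i cs cs≤x
... | false = []

LeftOf : ℕ → ℕ → Column → Set
LeftOf x k c = proj₁ c ≤ x × k < proj₂ c

module _ {x k : ℕ} {cs : List Column} (left : All (LeftOf x k) cs) where

  private
    tops≤ : All (λ c → proj₁ c ≤ x) cs
    tops≤ = All.map proj₁ left

    longer : ∀ {i} → i ≤ k → All (λ c → i < proj₂ c) cs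
    longer i≤k = All.map (λ c → ≤-<-trans i≤k (proj₂ c)) left

  insertRow-bumps : ∀ i ds → i < k →
    insertRow (x + i) (row i (cs ++ (suc x , k) ∷ ds))
      ≡ (row i (cs ++ (x , suc k) ∷ ds) , just (suc x + i))
  insertRow-bumps i ds i<k
    rewrite row-++ i cs ((suc x , k) ∷ ds) (longer (<⇒≤ i<k))
          | row-++ i cs ((x , suc k) ∷ ds) (longer (<⇒≤ i<k))
          | m<n⇒m<ᵇn≡true i<k | m<n⇒m<ᵇn≡true (m≤n⇒m≤1+n i<k)
          | insertRow-++ (x + i) (row i cs) (suc x + i ∷ row i ds) (row-bounded x i cs tops≤)
          | m<n⇒m<ᵇn≡true (n<1+n (x + i)) = refl

  insertRow-settles : ∀ ds → height ds ≤ k →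
    insertRow (x + k) (row k (cs ++ (suc x , k) ∷ ds)) ≡ (row k (cs ++ (x , suc k) ∷ ds) , nothing)
  insertRow-settles ds ds≤k
    rewrite row-++ k cs ((suc x , k) ∷ ds) (longer ≤-refl)
          | row-++ k cs ((x , suc k) ∷ ds) (longer ≤-refl)
          | n≤m⇒m<ᵇn≡false {k} ≤-refl | m<n⇒m<ᵇn≡true (n<1+n k) | row-short k ds ds≤k
          | insertRow-++ (x + k) (row k cs) [] (row-bounded x k cs tops≤) = refl

  insertT-rowsFrom : ∀ i h ds → height ds ≤ k → i ≤ k → k < i + h →
    insertT (x + i) (rowsFrom i h (cs ++ (suc x , k) ∷ ds)) ≡ rowsFrom i h (cs ++ (x , suc k) ∷ ds)
  insertT-rowsFrom i zero ds ds≤k i≤k k<i+0 = ⊥-elim (<⇒≱ (subst (k <_) (+-identityʳ i) k<i+0) i≤k)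
  insertT-rowsFrom i (suc h) ds ds≤k i≤k k<i+h with m≤n⇒m<n∨m≡n i≤k
  ... | inj₁ i<k = begin
      insertT (x + i) (row i old ∷ rowsFrom (suc i) h old)
    ≡⟨ insertT-bump (x + i) (row i old) (rowsFrom (suc i) h old) (insertRow-bumps i ds i<k) ⟩
      row i new ∷ insertT (suc x + i) (rowsFrom (suc i) h old)
    ≡⟨ cong (λ z → row i new ∷ insertT z (rowsFrom (suc i) h old)) (sym (+-suc x i)) ⟩
      row i new ∷ insertT (x + suc i) (rowsFrom (suc i) h old)
    ≡⟨ cong (row i new ∷_) (insertT-rowsFrom (suc i) h ds ds≤k i<k (subst (k <_) (+-suc i h) k<i+h)) ⟩
      row i new ∷ rowsFrom (suc i) h new
    ∎
    where
      old = cs ++ (suc x , k) ∷ ds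
      new = cs ++ (x , suc k) ∷ ds
  ... | inj₂ refl = begin
      insertT (x + i) (row i old ∷ rowsFrom (suc i) h old)
    ≡⟨ insertT-settle (x + i) (row i old) (rowsFrom (suc i) h old) (insertRow-settles ds ds≤k) ⟩
      row i new ∷ rowsFrom (suc i) h old
    ≡⟨ cong (row i new ∷_) (rowsFrom-cut (suc i) h cs _ (n≤1+n i)) ⟩
      row i new ∷ rowsFrom (suc i) h cs
    ≡⟨ cong (row i new ∷_) (sym (rowsFrom-cut (suc i) h cs _ ≤-refl)) ⟩
      row i new ∷ rowsFrom (suc i) h new
    ∎
    where
      old = cs ++ (suc x , i) ∷ ds
      new = cs ++ (x , suc i) ∷ ds

insertT-rowsFrom-new : ∀ x k i h ds → height ds ≤ k → i + h ≡ k →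
  insertT (x + i) (rowsFrom i h ((suc x , k) ∷ ds)) ≡ rowsFrom i (suc h) ((x , suc k) ∷ ds)
insertT-rowsFrom-new x k i zero ds ds≤k i+0≡k with trans (sym (+-identityʳ i)) i+0≡k
... | refl rewrite m<n⇒m<ᵇn≡true (n<1+n i) | row-short i ds ds≤k = refl
insertT-rowsFrom-new x k i (suc h) ds ds≤k i+h≡k = begin
    insertT (x + i) (row i old ∷ rowsFrom (suc i) h old)
  ≡⟨ insertT-bump (x + i) (row i old) (rowsFrom (suc i) h old) (insertRow-bumps [] i ds i<k) ⟩
    row i new ∷ insertT (suc x + i) (rowsFrom (suc i) h old)
  ≡⟨ cong (λ z → row i new ∷ insertT z (rowsFrom (suc i) h old)) (sym (+-suc x i)) ⟩
    row i new ∷ insertT (x + suc i) (rowsFrom (suc i) h old)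
  ≡⟨ cong (row i new ∷_) (insertT-rowsFrom-new x k (suc i) h ds ds≤k (trans (sym (+-suc i h)) i+h≡k)) ⟩
    row i new ∷ rowsFrom (suc i) (suc h) new
  ∎
  where
    old = (suc x , k) ∷ ds
    new = (x , suc k) ∷ ds
    i<k : i < k
    i<k = subst (i <_) i+h≡k (m<m+n i z<s)

insertT-extend-column : ∀ x k cs ds → All (LeftOf x k) cs → height ds ≤ k →
  insertT x (columnTableau (cs ++ (suc x , k) ∷ ds)) ≡ columnTableau (cs ++ (x , suc k) ∷ ds)
insertT-extend-column x k cs ds left ds≤k =
  subst (λ z → insertT z (columnTableau (cs ++ (suc x , k) ∷ ds)) ≡ columnTableau (cs ++ (x , suc k) ∷ ds))
    (+-identityʳ x) (shifted cs left)
  where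
    shifted : ∀ cs → All (LeftOf x k) cs →
      insertT (x + 0) (columnTableau (cs ++ (suc x , k) ∷ ds)) ≡ columnTableau (cs ++ (x , suc k) ∷ ds)
    shifted []       []   = insertT-rowsFrom-new x k 0 k ds ds≤k refl
    shifted (c ∷ cs) left = insertT-rowsFrom left 0 (proj₂ c) ds ds≤k z≤n (proj₂ (All.head left))

columnTableau-++-empty : ∀ cs t → columnTableau (cs ++ (t , 0) ∷ []) ≡ columnTableau cs
columnTableau-++-empty []       t = refl
columnTableau-++-empty (c ∷ cs) t = rowsFrom-cut 0 (proj₂ c) (c ∷ cs) ((t , 0) ∷ []) z≤n

insertT-new-column : ∀ x cs → All (LeftOf x 0) cs →
  insertT x (columnTableau cs) ≡ columnTableau (cs ++ (x , 1) ∷ [])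
insertT-new-column x cs left = begin
    insertT x (columnTableau cs)
  ≡⟨ cong (insertT x) (sym (columnTableau-++-empty cs (suc x))) ⟩
    insertT x (columnTableau (cs ++ (suc x , 0) ∷ []))
  ≡⟨ insertT-extend-column x 0 cs [] left z≤n ⟩
    columnTableau (cs ++ (x , 1) ∷ [])
  ∎

insertAll : Tableau → List ℕ → Tableau
insertAll T w = foldl (λ T a → insertT a T) T w

insertAll-++ : ∀ T u v → insertAll T (u ++ v) ≡ insertAll (insertAll T u) v
insertAll-++ = foldl-++ (λ T a → insertT a T)

countdown : ℕ → ℕ → List ℕ
countdown b zero    = []
countdown b (suc l) = b + l ∷ countdown b l

insertAll-countdown : ∀ b l k cs ds → All (λ c → proj₁ c ≤ b × k + l ≤ proj₂ c) cs → height ds ≤ k →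
  insertAll (columnTableau (cs ++ (b + l , k) ∷ ds)) (countdown b l) ≡ columnTableau (cs ++ (b , k + l) ∷ ds)
insertAll-countdown b zero k cs ds left ds≤k rewrite +-identityʳ b | +-identityʳ k = refl
insertAll-countdown b (suc l) k cs ds left ds≤k = begin
    insertAll (insertT (b + l) (columnTableau (cs ++ (b + suc l , k) ∷ ds))) (countdown b l)
  ≡⟨ cong (λ z → insertAll (insertT (b + l) (columnTableau (cs ++ (z , k) ∷ ds))) (countdown b l)) (+-suc b l) ⟩
    insertAll (insertT (b + l) (columnTableau (cs ++ (suc (b + l) , k) ∷ ds))) (countdown b l)
  ≡⟨ cong (λ T → insertAll T (countdown b l)) (insertT-extend-column (b + l) k cs ds left′ ds≤k) ⟩
    insertAll (columnTableau (cs ++ (b + l , suc k) ∷ ds)) (countdown b l)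
  ≡⟨ insertAll-countdown b l (suc k) cs ds left″ (m≤n⇒m≤1+n ds≤k) ⟩
    columnTableau (cs ++ (b , suc k + l) ∷ ds)
  ≡⟨ cong (λ z → columnTableau (cs ++ (b , z) ∷ ds)) (sym (+-suc k l)) ⟩
    columnTableau (cs ++ (b , k + suc l) ∷ ds)
  ∎
  where
    left′ : All (LeftOf (b + l) k) cs
    left′ = All.map (λ (t≤b , kl≤) → ≤-trans t≤b (m≤m+n b l) , <-≤-trans (m<m+n k z<s) kl≤) left
    left″ : All (λ c → proj₁ c ≤ b × suc k + l ≤ proj₂ c) cs
    left″ = All.map (λ (t≤b , kl≤) → t≤b , ≤-trans (≤-reflexive (sym (+-suc k l))) kl≤) left

-- As a map on positions, block lo len ex sends lo ↦ lo+len-1 ↦ lo+1 ↦ lo+len-2 ↦ ⋯ and the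
-- last point of this zigzag to ex; as a word it is two decreasing runs separated by ex.
block : ℕ → ℕ → ℕ → List ℕ
block lo zero    ex = []
block lo (suc l) ex =
  countdown (lo + (suc l ∸ ⌊ suc l /2⌋)) ⌊ suc l /2⌋ ++ ex ∷ countdown (suc lo) (l ∸ ⌊ suc l /2⌋)

⌊1+n/2⌋≤n : ∀ n → ⌊ suc n /2⌋ ≤ n
⌊1+n/2⌋≤n n = ≤-pred (⌊n/2⌋<n n)

insertAll-countdown-∷ʳ : ∀ b h ex k cs → suc h ≤ k → ex < b → All (LeftOf ex k) cs →
  insertAll (columnTableau (cs ++ (suc ex , k) ∷ (b + h , 1) ∷ [])) (countdown b h ++ ex ∷ [])
    ≡ columnTableau (cs ++ (ex , suc k) ∷ (b , suc h) ∷ [])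
insertAll-countdown-∷ʳ b h ex k cs h<k ex<b left = begin
    insertAll (columnTableau (cs ++ (suc ex , k) ∷ (b + h , 1) ∷ [])) (countdown b h ++ ex ∷ [])
  ≡⟨ insertAll-++ _ (countdown b h) (ex ∷ []) ⟩
    insertT ex (insertAll (columnTableau (cs ++ (suc ex , k) ∷ (b + h , 1) ∷ [])) (countdown b h))
  ≡⟨ cong (λ z → insertT ex (insertAll (columnTableau z) (countdown b h))) (sym (++-assoc cs _ _)) ⟩
    insertT ex (insertAll (columnTableau (cs₁ ++ (b + h , 1) ∷ [])) (countdown b h))
  ≡⟨ cong (insertT ex) (insertAll-countdown b h 1 cs₁ [] left₁ z≤n) ⟩
    insertT ex (columnTableau (cs₁ ++ (b , suc h) ∷ []))
  ≡⟨ cong (λ z → insertT ex (columnTableau z)) (++-assoc cs _ _) ⟩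
    insertT ex (columnTableau (cs ++ (suc ex , k) ∷ (b , suc h) ∷ []))
  ≡⟨ insertT-extend-column ex k cs _ left h<k ⟩
    columnTableau (cs ++ (ex , suc k) ∷ (b , suc h) ∷ [])
  ∎
  where
    cs₁ = cs ++ (suc ex , k) ∷ []
    left₁ : All (λ c → proj₁ c ≤ b × 1 + h ≤ proj₂ c) cs₁
    left₁ = All.++⁺ (All.map (λ (t≤ex , k<) → ≤-trans t≤ex (<⇒≤ ex<b) , ≤-trans h<k (<⇒≤ k<)) left)
                    ((ex<b , h<k) ∷ [])

insertAll-block : ∀ lo len ex k cs → 1 ≤ len → len ≤ k → ex < lo → All (LeftOf ex k) cs →
  insertAll (columnTableau (cs ++ (suc ex , k) ∷ (lo + len , 1) ∷ [])) (block lo len ex)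
    ≡ columnTableau (cs ++ (ex , suc k) ∷ (suc lo , len) ∷ [])
insertAll-block lo (suc l) ex k cs _ len≤k ex<lo left = begin
    insertAll (columnTableau (cs ++ (suc ex , k) ∷ (lo + suc l , 1) ∷ [])) (run₁ ++ ex ∷ run₂)
  ≡⟨ cong (insertAll _) (sym (++-assoc run₁ (ex ∷ []) run₂)) ⟩
    insertAll (columnTableau (cs ++ (suc ex , k) ∷ (lo + suc l , 1) ∷ [])) ((run₁ ++ ex ∷ []) ++ run₂)
  ≡⟨ insertAll-++ _ (run₁ ++ ex ∷ []) run₂ ⟩
    insertAll (insertAll (columnTableau (cs ++ (suc ex , k) ∷ (lo + suc l , 1) ∷ [])) (run₁ ++ ex ∷ [])) run₂
  ≡⟨ cong (λ t → insertAll (insertAll (columnTableau (cs ++ (suc ex , k) ∷ (t , 1) ∷ [])) (run₁ ++ ex ∷ [])) run₂)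
          top≡ ⟩
    insertAll (insertAll (columnTableau (cs ++ (suc ex , k) ∷ (b + h , 1) ∷ [])) (run₁ ++ ex ∷ [])) run₂
  ≡⟨ cong (λ T → insertAll T run₂) (insertAll-countdown-∷ʳ b h ex k cs h<k (≤-trans ex<lo (m≤m+n lo _)) left) ⟩
    insertAll (columnTableau (cs ++ (ex , suc k) ∷ (b , suc h) ∷ [])) run₂
  ≡⟨ cong (λ z → insertAll (columnTableau z) run₂)
          (trans (cong (λ z → cs ++ (ex , suc k) ∷ (z , suc h) ∷ []) b≡) (sym (++-assoc cs _ _))) ⟩
    insertAll (columnTableau (cs₂ ++ (suc lo + (l ∸ h) , suc h) ∷ [])) run₂
  ≡⟨ insertAll-countdown (suc lo) (l ∸ h) (suc h) cs₂ [] left₂ z≤n ⟩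
    columnTableau (cs₂ ++ (suc lo , suc h + (l ∸ h)) ∷ [])
  ≡⟨ cong (λ z → columnTableau (cs₂ ++ (suc lo , z) ∷ [])) len≡ ⟩
    columnTableau (cs₂ ++ (suc lo , suc l) ∷ [])
  ≡⟨ cong columnTableau (++-assoc cs _ _) ⟩
    columnTableau (cs ++ (ex , suc k) ∷ (suc lo , suc l) ∷ [])
  ∎
  where
    h = ⌊ suc l /2⌋
    h≤l = ⌊1+n/2⌋≤n l
    h<k : suc h ≤ k
    h<k = ≤-trans (s≤s h≤l) len≤k
    b = lo + (suc l ∸ h)
    run₁ = countdown b h
    run₂ = countdown (suc lo) (l ∸ h)
    cs₂ = cs ++ (ex , suc k) ∷ []
    top≡ : lo + suc l ≡ b + h
    top≡ = trans (cong (lo +_) (sym (m∸n+n≡m (m≤n⇒m≤1+n h≤l)))) (sym (+-assoc lo _ h))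
    b≡ : b ≡ suc lo + (l ∸ h)
    b≡ = trans (cong (lo +_) (+-∸-assoc 1 h≤l)) (+-suc lo (l ∸ h))
    len≡ : suc h + (l ∸ h) ≡ suc l
    len≡ = cong suc (m+[n∸m]≡n h≤l)
    ex≤lo : ex ≤ suc lo
    ex≤lo = ≤-trans (<⇒≤ ex<lo) (n≤1+n lo)
    left₂ : All (λ c → proj₁ c ≤ suc lo × suc h + (l ∸ h) ≤ proj₂ c) cs₂
    left₂ = All.++⁺ (All.map (λ (t≤ex , k<) → ≤-trans t≤ex ex≤lo ,
                                               ≤-trans (≤-reflexive len≡) (≤-trans len≤k (<⇒≤ k<))) left)
                    ((ex≤lo , ≤-trans (≤-reflexive len≡) (m≤n⇒m≤1+n len≤k)) ∷ [])

insertAll-first-block : ∀ l ex → suc (suc l) < ex →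
  insertAll [] (block 1 (suc (suc l)) ex) ≡ columnTableau ((2 , suc l) ∷ (ex , 1) ∷ [])
insertAll-first-block l ex c₁<ex = begin
    insertAll (insertT (b + h) []) (run₁ ++ ex ∷ run₂)
  ≡⟨ cong (λ T → insertAll T (run₁ ++ ex ∷ run₂)) (insertT-new-column (b + h) [] []) ⟩
    insertAll (columnTableau ((b + h , 1) ∷ [])) (run₁ ++ ex ∷ run₂)
  ≡⟨ insertAll-++ _ run₁ (ex ∷ run₂) ⟩
    insertAll (insertAll (columnTableau ((b + h , 1) ∷ [])) run₁) (ex ∷ run₂)
  ≡⟨ cong (λ T → insertAll T (ex ∷ run₂)) (insertAll-countdown b h 1 [] [] [] z≤n) ⟩
    insertAll (insertT ex (columnTableau ((b , suc h) ∷ []))) run₂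
  ≡⟨ cong (λ T → insertAll T run₂) (insertT-new-column ex ((b , suc h) ∷ []) ((b≤ex , z<s) ∷ [])) ⟩
    insertAll (columnTableau ((b , suc h) ∷ (ex , 1) ∷ [])) run₂
  ≡⟨ cong (λ z → insertAll (columnTableau ((z , suc h) ∷ (ex , 1) ∷ [])) run₂) b≡ ⟩
    insertAll (columnTableau ([] ++ (2 + (l ∸ h) , suc h) ∷ (ex , 1) ∷ [])) run₂
  ≡⟨ insertAll-countdown 2 (l ∸ h) (suc h) [] ((ex , 1) ∷ []) [] (s≤s z≤n) ⟩
    columnTableau ((2 , suc h + (l ∸ h)) ∷ (ex , 1) ∷ [])
  ≡⟨ cong (λ z → columnTableau ((2 , suc z) ∷ (ex , 1) ∷ [])) (m+[n∸m]≡n h≤l) ⟩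
    columnTableau ((2 , suc l) ∷ (ex , 1) ∷ [])
  ∎
  where
    h = ⌊ l /2⌋
    h≤l = ⌊n/2⌋≤n l
    b = 1 + (suc l ∸ h)
    run₁ = countdown b h
    run₂ = countdown 2 (l ∸ h)
    b≡ : b ≡ 2 + (l ∸ h)
    b≡ = cong suc (+-∸-assoc 1 h≤l)
    b≤ex : b ≤ ex
    b≤ex = ≤-trans (s≤s (m∸n≤m (suc l) h)) (<⇒≤ c₁<ex)

nth : List ℕ → ℕ → ℕ
nth []       _       = 0
nth (x ∷ _)  zero    = x
nth (_ ∷ xs) (suc i) = nth xs i

nth-++ˡ : ∀ xs ys {i} → i < length xs → nth (xs ++ ys) i ≡ nth xs i
nth-++ˡ (x ∷ xs) ys {zero}  _         = refl
nth-++ˡ (x ∷ xs) ys {suc i} (s≤s i<n) = nth-++ˡ xs ys i<n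

nth-++ʳ : ∀ xs ys i → nth (xs ++ ys) (length xs + i) ≡ nth ys i
nth-++ʳ []       ys i = refl
nth-++ʳ (x ∷ xs) ys i = nth-++ʳ xs ys i

∈⇒nth : ∀ {x} xs → x ∈ xs → ∃ λ a → a < length xs × nth xs a ≡ x
∈⇒nth (y ∷ xs) (here x≡y) = 0 , z<s , sym x≡y
∈⇒nth (y ∷ xs) (there x∈xs) with ∈⇒nth xs x∈xs
... | a , a<n , eq = suc a , s<s a<n , eq

nth-0-∈ : ∀ {x xs} → x ∈ xs → nth xs 0 ∈ xs
nth-0-∈ {xs = y ∷ _} _ = here refl

applyUpTo-nth : ∀ xs → applyUpTo (nth xs) (length xs) ≡ xs
applyUpTo-nth []       = refl
applyUpTo-nth (x ∷ xs) = cong (x ∷_) (applyUpTo-nth xs)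

applyUpTo-cong : ∀ {f g : ℕ → ℕ} h → (∀ {j} → j < h → f j ≡ g j) → applyUpTo f h ≡ applyUpTo g h
applyUpTo-cong zero    f≡g = refl
applyUpTo-cong (suc h) f≡g = cong₂ _∷_ (f≡g z<s) (applyUpTo-cong h (λ j<h → f≡g (s<s j<h)))

-- Conjugate partitions

leadingAbove : ℕ → List ℕ → ℕ
leadingAbove i []       = 0
leadingAbove i (k ∷ ks) with i <ᵇ k
... | true  = suc (leadingAbove i ks)
... | false = 0

head₀ : List ℕ → ℕ
head₀ []      = 0
head₀ (k ∷ _) = k

-- For a partition, leadingAbove j counts the rows longer than j, i.e. the length of column j.
conjugate : List ℕ → List ℕ
conjugate ks = applyUpTo (λ j → leadingAbove j ks) (head₀ ks)

length-row : ∀ i cs → length (row i cs) ≡ leadingAbove i (map proj₂ cs)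
length-row i []             = refl
length-row i ((t , k) ∷ cs) with i <ᵇ k
... | true  = cong suc (length-row i cs)
... | false = refl

Γ-rowsFrom : ∀ i h cs → Γ (rowsFrom i h cs) ≡ applyUpTo (λ j → leadingAbove (i + j) (map proj₂ cs)) h
Γ-rowsFrom i zero    cs = refl
Γ-rowsFrom i (suc h) cs = cong₂ _∷_
  (trans (length-row i cs) (cong (λ z → leadingAbove z (map proj₂ cs)) (sym (+-identityʳ i))))
  (trans (Γ-rowsFrom (suc i) h cs)
         (applyUpTo-cong h (λ {j} _ → cong (λ z → leadingAbove z (map proj₂ cs)) (sym (+-suc i j)))))

Γ-columnTableau : ∀ cs → Γ (columnTableau cs) ≡ conjugate (map proj₂ cs)
Γ-columnTableau []             = refl
Γ-columnTableau ((t , k) ∷ cs) = Γ-rowsFrom 0 k ((t , k) ∷ cs)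

leadingAbove-applyUpTo : ∀ i F a m → (∀ j → i < F j → j < m) → (∀ j → j < m → i < F j) → m ≤ a →
  leadingAbove i (applyUpTo F a) ≡ m
leadingAbove-applyUpTo i F zero zero _ _ _ = refl
leadingAbove-applyUpTo i F (suc a) zero below _ _ with i <ᵇ F 0 in eq
... | true  = ⊥-elim (<⇒≱ (below 0 (<ᵇ⇒< i (F 0) (subst T (sym eq) tt))) z≤n)
... | false = refl
leadingAbove-applyUpTo i F (suc a) (suc m) below above (s≤s m≤a) rewrite m<n⇒m<ᵇn≡true (above 0 z<s) =
  cong suc (leadingAbove-applyUpTo i (λ j → F (suc j)) a m
    (λ j i<F → ≤-pred (below (suc j) i<F)) (λ j j<m → above (suc j) (s≤s j<m)) m≤a)

<leadingAbove⇒<nth : ∀ ks i j → i < leadingAbove j ks → j < nth ks i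
<leadingAbove⇒<nth (k ∷ ks) i j i<lead with j <ᵇ k in eq
<leadingAbove⇒<nth (k ∷ ks) zero    j _          | true = <ᵇ⇒< j k (subst T (sym eq) tt)
<leadingAbove⇒<nth (k ∷ ks) (suc i) j (s≤s i<lead) | true = <leadingAbove⇒<nth ks i j i<lead

nth≤head₀ : ∀ ks i → Linked _≥_ ks → nth ks i ≤ head₀ ks
nth≤head₀ []           i       _          = z≤n
nth≤head₀ (k ∷ ks)     zero    _          = ≤-refl
nth≤head₀ (k ∷ [])     (suc i) _          = z≤n
nth≤head₀ (k ∷ l ∷ ks) (suc i) (l≤k ∷ ls) = ≤-trans (nth≤head₀ (l ∷ ks) i ls) l≤k

<nth⇒<leadingAbove : ∀ ks i j → Linked _≥_ ks → j < nth ks i → i < leadingAbove j ks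
<nth⇒<leadingAbove (k ∷ ks) i j ls j<nth
  rewrite m<n⇒m<ᵇn≡true (<-≤-trans j<nth (nth≤head₀ (k ∷ ks) i ls)) with i | ks | ls
... | zero  | _      | _        = z<s
... | suc i | l ∷ ks | _ ∷ ls′  = s≤s (<nth⇒<leadingAbove (l ∷ ks) i j ls′ j<nth)

leadingAbove-0 : ∀ ks → All (1 ≤_) ks → leadingAbove 0 ks ≡ length ks
leadingAbove-0 []       []           = refl
leadingAbove-0 (k ∷ ks) (1≤k ∷ 1≤ks) rewrite m<n⇒m<ᵇn≡true 1≤k = cong suc (leadingAbove-0 ks 1≤ks)

leadingAbove-antitone : ∀ {j j′} ks → j ≤ j′ → leadingAbove j′ ks ≤ leadingAbove j ks
leadingAbove-antitone []       _    = z≤n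
leadingAbove-antitone {j} {j′} (k ∷ ks) j≤j′ with j′ <ᵇ k in eq
... | false = z≤n
... | true rewrite m<n⇒m<ᵇn≡true {j} {k} (≤-<-trans j≤j′ (<ᵇ⇒< j′ k (subst T (sym eq) tt))) =
  s≤s (leadingAbove-antitone ks j≤j′)

conjugate-involutive : ∀ ks → All (1 ≤_) ks → Linked _≥_ ks → conjugate (conjugate ks) ≡ ks
conjugate-involutive []                _   _  = refl
conjugate-involutive (zero ∷ _)        (() ∷ _) _
conjugate-involutive ks@(suc k ∷ ks′) 1≤ks ls = begin
    applyUpTo (λ i → leadingAbove i cks) (leadingAbove 0 ks)
  ≡⟨ cong (applyUpTo (λ i → leadingAbove i cks)) (leadingAbove-0 ks 1≤ks) ⟩
    applyUpTo (λ i → leadingAbove i cks) (length ks)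
  ≡⟨ applyUpTo-cong (length ks) (λ {i} _ → leadingAbove-applyUpTo i _ (suc k) (nth ks i)
       (λ j → <leadingAbove⇒<nth ks i j) (λ j → <nth⇒<leadingAbove ks i j ls) (nth≤head₀ ks i ls)) ⟩
    applyUpTo (nth ks) (length ks)
  ≡⟨ applyUpTo-nth ks ⟩
    ks
  ∎
  where cks = conjugate ks

leadingAbove-positive : ∀ {j k} ks → j < k → 1 ≤ leadingAbove j (k ∷ ks)
leadingAbove-positive ks j<k rewrite m<n⇒m<ᵇn≡true j<k = s≤s z≤n

conjugate-positive : ∀ ks → All (1 ≤_) (conjugate ks)
conjugate-positive []       = []
conjugate-positive (k ∷ ks) = All.applyUpTo⁺₁ _ k (leadingAbove-positive ks)

conjugate-nonincreasing : ∀ ks → Linked _≥_ (conjugate ks)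
conjugate-nonincreasing ks = Linked.applyUpTo⁺₂ _ (head₀ ks) (λ j → leadingAbove-antitone ks (n≤1+n j))

private
  cells : Maybe ℕ → ℕ
  cells (just _) = 1
  cells nothing  = 0

insertRow-size : ∀ a r → cells (proj₂ (insertRow a r)) + length (proj₁ (insertRow a r)) ≡ suc (length r)
insertRow-size a []       = refl
insertRow-size a (b ∷ bs) with a <ᵇ b
... | true  = refl
... | false = trans (+-suc (cells (proj₂ (insertRow a bs))) _) (cong suc (insertRow-size a bs))

insertT-size : ∀ a T → sum (Γ (insertT a T)) ≡ suc (sum (Γ T))
insertT-size a []       = refl
insertT-size a (r ∷ rs) with insertRow a r | insertRow-size a r
... | r′ , nothing | size = cong (_+ sum (Γ rs)) size
... | r′ , just b  | size = trans (cong (length r′ +_) (insertT-size b rs))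
                                 (trans (+-suc (length r′) _) (cong (λ z → suc (z + sum (Γ rs))) (suc-injective size)))

insertAll-size : ∀ T w → sum (Γ (insertAll T w)) ≡ sum (Γ T) + length w
insertAll-size T []      = sym (+-identityʳ _)
insertAll-size T (a ∷ w) = trans (insertAll-size (insertT a T) w)
  (trans (cong (_+ length w) (insertT-size a T)) (sym (+-suc _ (length w))))

-- Cyclic permutations from closed paths

-- The permutation with one-line notation W, on positions 1, 2, …
wordFun : List ℕ → ℕ → ℕ
wordFun W p = nth W (pred p)

Path : (ℕ → ℕ) → List ℕ → ℕ → Set
Path g []           z = ⊤
Path g (x ∷ [])     z = g x ≡ z
Path g (x ∷ y ∷ xs) z = g x ≡ y × Path g (y ∷ xs) z

module _ {g : ℕ → ℕ} where

  path-++ : ∀ xs {y ys z} → Path g xs y → Path g (y ∷ ys) z → Path g (xs ++ y ∷ ys) z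
  path-++ []           _          q = q
  path-++ (x ∷ [])     p          q = p , q
  path-++ (x ∷ x′ ∷ xs) (p , ps) q = p , path-++ (x′ ∷ xs) ps q

  path-++⁻ : ∀ xs {y ys z} → Path g (xs ++ y ∷ ys) z → Path g xs y × Path g (y ∷ ys) z
  path-++⁻ []            q       = tt , q
  path-++⁻ (x ∷ [])      (p , q) = p , q
  path-++⁻ (x ∷ x′ ∷ xs) (p , q) = let (r , s) = path-++⁻ (x′ ∷ xs) q in (p , r) , s

  path-cong : ∀ {f} xs {z} → All (λ p → g p ≡ f p) xs → Path f xs z → Path g xs z
  path-cong []            []           _        = tt
  path-cong (x ∷ [])      (e ∷ [])     p        = trans e p
  path-cong (x ∷ x′ ∷ xs) (e ∷ es)     (p , ps) = trans e p , path-cong (x′ ∷ xs) es ps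

  path-∈ : ∀ {xs z x} → Path g xs z → x ∈ xs → g x ∈ xs ⊎ g x ≡ z
  path-∈ {x ∷ []}     p        (here refl) = inj₂ p
  path-∈ {x ∷ y ∷ xs} (p , _)  (here refl) = inj₁ (there (here p))
  path-∈ {x ∷ y ∷ xs} (_ , ps) (there x∈)  with path-∈ ps x∈
  ... | inj₁ gx∈ = inj₁ (there gx∈)
  ... | inj₂ gx≡ = inj₂ gx≡

  path-nth : ∀ {xs z} → Path g xs z → ∀ a → suc a < length xs → g (nth xs a) ≡ nth xs (suc a)
  path-nth {x ∷ []}     _        _       (s≤s ())
  path-nth {x ∷ y ∷ xs} (p , _)  zero    _         = p
  path-nth {x ∷ y ∷ xs} (_ , ps) (suc a) (s<s a<n) = path-nth ps a a<n

  path-last : ∀ {xs z} → Path g xs z → 1 ≤ length xs → g (nth xs (pred (length xs))) ≡ z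
  path-last {x ∷ []}     p        _ = p
  path-last {x ∷ y ∷ xs} (_ , ps) _ = path-last ps (s≤s z≤n)

path-splice : ∀ {f g} A a {s} S B {z} → Path f (A ++ a ∷ B) z → All (λ p → g p ≡ f p) (A ++ B) →
  g a ≡ s → Path g (s ∷ S) (f a) → Path g (A ++ a ∷ (s ∷ S) ++ B) z
path-splice {f} {g} A a {s} S B old agree ga≡s detour =
  path-++ A (path-cong A (All.++⁻ˡ A agree) before) (continue B after (All.++⁻ʳ A agree))
  where
    before = proj₁ (path-++⁻ A old)
    after  = proj₂ (path-++⁻ A old)
    continue : ∀ B {z} → Path f (a ∷ B) z → All (λ p → g p ≡ f p) B → Path g (a ∷ (s ∷ S) ++ B) z
    continue []      fa≡z  _        =
      ga≡s , subst (Path g ((s ∷ S) ++ [])) fa≡z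
               (subst (λ w → Path g w (f a)) (sym (++-identityʳ (s ∷ S))) detour)
    continue (b ∷ B) (fa≡b , pb) (e ∷ es) =
      ga≡s , path-++ (s ∷ S) (subst (Path g (s ∷ S)) fa≡b detour) (path-cong (b ∷ B) (e ∷ es) pb)

module ClosedPath {g : ℕ → ℕ} {L : List ℕ} (closed : Path g L (nth L 0)) where

  iterate-along : ∀ a t → a + t < length L → fold (nth L a) g t ≡ nth L (a + t)
  iterate-along a zero    _     = cong (nth L) (sym (+-identityʳ a))
  iterate-along a (suc t) a+t<n = begin
      g (fold (nth L a) g t)  ≡⟨ cong g (iterate-along a t (<-trans (+-monoʳ-< a (n<1+n t)) a+t<n)) ⟩
      g (nth L (a + t))       ≡⟨ path-nth closed (a + t) (subst (_< length L) (+-suc a t) a+t<n) ⟩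
      nth L (suc (a + t))     ≡⟨ cong (nth L) (sym (+-suc a t)) ⟩
      nth L (a + suc t)       ∎

  iterate-wraps : ∀ a d → suc (a + d) ≡ length L → fold (nth L a) g (suc d) ≡ nth L 0
  iterate-wraps a d a+d+1≡n = begin
      g (fold (nth L a) g d)          ≡⟨ cong g (iterate-along a d (≤-reflexive a+d+1≡n)) ⟩
      g (nth L (a + d))               ≡⟨ cong (λ i → g (nth L i)) (cong pred a+d+1≡n) ⟩
      g (nth L (pred (length L)))     ≡⟨ path-last closed (subst (1 ≤_) a+d+1≡n (s≤s z≤n)) ⟩
      nth L 0                         ∎

  private
    iterate-from-start : ∀ a d b → suc (a + d) ≡ length L → b < length L →
      fold (nth L a) g (b + suc d) ≡ nth L b
    iterate-from-start a d b e b<n = begin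
      fold (nth L a) g (b + suc d)       ≡⟨ fold-+ (nth L a) g b ⟩
      fold (fold (nth L a) g (suc d)) g b ≡⟨ cong (λ x → fold x g b) (iterate-wraps a d e) ⟩
      fold (nth L 0) g b                  ≡⟨ iterate-along 0 b b<n ⟩
      nth L b                             ∎

  iterate-connects : ∀ {x y} → x ∈ L → y ∈ L → ∃ λ t → fold x g t ≡ y
  iterate-connects x∈L y∈L with ∈⇒nth L x∈L | ∈⇒nth L y∈L
  ... | a , a<n , refl | b , b<n , refl with ≤-<-connex a b
  ...   | inj₁ a≤b = b ∸ a , trans (iterate-along a (b ∸ a) (subst (_< length L) (sym (m+[n∸m]≡n a≤b)) b<n))
                                   (cong (nth L) (m+[n∸m]≡n a≤b))
  ...   | inj₂ b<a = b + suc (length L ∸ suc a) , iterate-from-start a _ b (m+[n∸m]≡n a<n) b<n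

  iterate-period : ∀ {x} → x ∈ L → fold x g (length L) ≡ x
  iterate-period x∈L with ∈⇒nth L x∈L
  ... | a , a<n , refl = begin
      fold (nth L a) g (length L)                  ≡⟨ cong (fold (nth L a) g) (sym n≡) ⟩
      fold (nth L a) g (a + suc (length L ∸ suc a)) ≡⟨ iterate-from-start a _ a (m+[n∸m]≡n a<n) a<n ⟩
      nth L a                                      ∎
    where
      n≡ : a + suc (length L ∸ suc a) ≡ length L
      n≡ = trans (+-suc a _) (m+[n∸m]≡n a<n)

  maps-into : ∀ {x} → x ∈ L → g x ∈ L
  maps-into x∈L with path-∈ closed x∈L
  ... | inj₁ gx∈L = gx∈L
  ... | inj₂ gx≡  = subst (_∈ L) (sym gx≡) (nth-0-∈ x∈L)

fold-suc : ∀ {A : Set} (f : A → A) x m → fold (f x) f m ≡ f (fold x f m)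
fold-suc f x m = trans (sym (fold-+ x f m {1})) (cong (fold x f) (+-comm m 1))

periodic⇒permutation : ∀ n (g : ℕ → ℕ) →
  (∀ p → 1 ≤ p → p ≤ n → 1 ≤ g p × g p ≤ n) → (∀ p → 1 ≤ p → p ≤ n → fold p g n ≡ p) →
  Σ (Permutation′ n) λ σ → ∀ k i → suc (toℕ (iter σ k i)) ≡ fold (suc (toℕ i)) g k
periodic⇒permutation zero    g _    _      = idₚ , λ _ ()
periodic⇒permutation (suc m) g into period = σ , iter-σ
  where
    ĝ : Fin (suc m) → ℕ
    ĝ i = g (suc (toℕ i))

    range : ∀ i → 1 ≤ ĝ i × ĝ i ≤ suc m
    range i = into (suc (toℕ i)) (s≤s z≤n) (toℕ<n i)

    pred-ĝ< : ∀ i → pred (ĝ i) < suc m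
    pred-ĝ< i = ≤-trans (≤-reflexive (suc-pred (ĝ i) {{>-nonZero (proj₁ (range i))}})) (proj₂ (range i))

    σ⁺ : Fin (suc m) → Fin (suc m)
    σ⁺ i = fromℕ< (pred-ĝ< i)

    σ⁺-spec : ∀ i → suc (toℕ (σ⁺ i)) ≡ ĝ i
    σ⁺-spec i = trans (cong suc (toℕ-fromℕ< (pred-ĝ< i))) (suc-pred (ĝ i) {{>-nonZero (proj₁ (range i))}})

    iter-σ⁺ : ∀ k i → suc (toℕ (fold i σ⁺ k)) ≡ fold (suc (toℕ i)) g k
    iter-σ⁺ zero    i = refl
    iter-σ⁺ (suc k) i = trans (σ⁺-spec (fold i σ⁺ k)) (cong g (iter-σ⁺ k i))

    σ⁺-period : ∀ i → fold i σ⁺ (suc m) ≡ i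
    σ⁺-period i = toℕ-injective (suc-injective
      (trans (iter-σ⁺ (suc m) i) (period (suc (toℕ i)) (s≤s z≤n) (toℕ<n i))))

    σ : Permutation′ (suc m)
    σ = permutation σ⁺ (λ i → fold i σ⁺ m) σ⁺-period
          (λ i → trans (fold-suc σ⁺ i m) (σ⁺-period i))

    iter-σ : ∀ k i → suc (toℕ (iter σ k i)) ≡ fold (suc (toℕ i)) g k
    iter-σ k i = trans (cong (λ j → suc (toℕ j)) (iter≡fold k)) (iter-σ⁺ k i)
      where
        iter≡fold : ∀ k → iter σ k i ≡ fold i σ⁺ k
        iter≡fold zero    = refl
        iter≡fold (suc k) = cong σ⁺ (iter≡fold k)

tabulate-nth : ∀ xs → tabulate (λ (i : Fin (length xs)) → nth xs (toℕ i)) ≡ xs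
tabulate-nth []       = refl
tabulate-nth (x ∷ xs) = cong (x ∷_) (tabulate-nth xs)

cycle⇒cyclic-permutation : ∀ W L → length L ≡ length W → Path (wordFun W) L (nth L 0) →
  (∀ p → 1 ≤ p → p ≤ length W → p ∈ L) → All (λ p → 1 ≤ p × p ≤ length W) L →
  Σ (Permutation′ (length W)) λ σ → IsCyclic σ × oneLine σ ≡ W
cycle⇒cyclic-permutation W L ∣L∣≡∣W∣ closed covers bounded = σ , cyclic , oneLine≡
  where
    open ClosedPath closed
    g = wordFun W
    n = length W

    σ-spec = periodic⇒permutation n g
      (λ p 1≤p p≤n → All.lookup bounded (maps-into (covers p 1≤p p≤n)))
      (λ p 1≤p p≤n → subst (λ k → fold p g k ≡ p) ∣L∣≡∣W∣ (iterate-period (covers p 1≤p p≤n)))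
    σ = proj₁ σ-spec
    iter-σ = proj₂ σ-spec

    covers-Fin : ∀ (i : Fin n) → suc (toℕ i) ∈ L
    covers-Fin i = covers (suc (toℕ i)) (s≤s z≤n) (toℕ<n i)

    cyclic : IsCyclic σ
    cyclic i j with iterate-connects (covers-Fin i) (covers-Fin j)
    ... | t , reaches = t , toℕ-injective (suc-injective (trans (iter-σ t i) reaches))

    oneLine≡ : oneLine σ ≡ W
    oneLine≡ = begin
      map (λ i → suc (toℕ (σ ⟨$⟩ʳ i))) (allFin n) ≡⟨ map-cong (iter-σ 1) (allFin n) ⟩
      map (λ i → nth W (toℕ i)) (allFin n)        ≡⟨ map-tabulate (λ i → i) (λ i → nth W (toℕ i)) ⟩
      tabulate (λ i → nth W (toℕ i))               ≡⟨ tabulate-nth W ⟩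
      W                                            ∎

length-countdown : ∀ b m → length (countdown b m) ≡ m
length-countdown b zero    = refl
length-countdown b (suc m) = cong suc (length-countdown b m)

countdown-snoc : ∀ b m → countdown b (suc m) ≡ countdown (suc b) m ++ b ∷ []
countdown-snoc b zero    = cong (_∷ []) (+-identityʳ b)
countdown-snoc b (suc m) = cong₂ _∷_ (+-suc b m) (countdown-snoc b m)

length-block : ∀ lo len ex → length (block lo len ex) ≡ len
length-block lo zero    ex = refl
length-block lo (suc l) ex = begin
    length (countdown _ h ++ ex ∷ countdown (suc lo) (l ∸ h))
  ≡⟨ length-++ (countdown _ h) ⟩
    length (countdown _ h) + suc (length (countdown (suc lo) (l ∸ h)))
  ≡⟨ cong₂ (λ a b → a + suc b) (length-countdown _ h) (length-countdown (suc lo) (l ∸ h)) ⟩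
    h + suc (l ∸ h)
  ≡⟨ trans (+-suc h _) (cong suc (m+[n∸m]≡n (⌊1+n/2⌋≤n l))) ⟩
    suc l
  ∎
  where h = ⌊ suc l /2⌋

block-unfold : ∀ lo k ex →
  block lo (3 + k) ex ≡ suc (lo + suc k) ∷ (block (suc lo) (suc k) ex ++ suc lo ∷ [])
block-unfold lo k ex = begin
    countdown (lo + (2 + k ∸ h)) (suc h) ++ ex ∷ countdown (suc lo) (1 + k ∸ h)
  ≡⟨ cong₂ (λ a b → a ∷ b) top≡ (cong₂ _++_ (cong (λ z → countdown z h) start≡) (cong (ex ∷_) tail≡)) ⟩
    suc (lo + suc k) ∷ (countdown (suc lo + (1 + k ∸ h)) h ++ ex ∷ (countdown (2 + lo) (k ∸ h) ++ suc lo ∷ []))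
  ≡⟨ cong (suc (lo + suc k) ∷_) (sym (++-assoc (countdown _ h) (ex ∷ countdown (2 + lo) (k ∸ h)) (suc lo ∷ []))) ⟩
    suc (lo + suc k) ∷ (block (suc lo) (suc k) ex ++ suc lo ∷ [])
  ∎
  where
    h = ⌊ suc k /2⌋
    h≤k : h ≤ k
    h≤k = ⌊1+n/2⌋≤n k
    top≡ : lo + (2 + k ∸ h) + h ≡ suc (lo + suc k)
    top≡ = trans (+-assoc lo _ h) (trans (cong (lo +_) (m∸n+n≡m (m≤n⇒m≤1+n (m≤n⇒m≤1+n h≤k)))) (+-suc lo (suc k)))
    start≡ : lo + (2 + k ∸ h) ≡ suc lo + (1 + k ∸ h)
    start≡ = trans (cong (lo +_) (+-∸-assoc 1 (≤-trans h≤k (n≤1+n k)))) (+-suc lo _)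
    tail≡ : countdown (suc lo) (1 + k ∸ h) ≡ countdown (2 + lo) (k ∸ h) ++ suc lo ∷ []
    tail≡ = trans (cong (countdown (suc lo)) (+-∸-assoc 1 h≤k)) (countdown-snoc (suc lo) (k ∸ h))

zigzag : ℕ → ℕ → List ℕ
zigzag lo zero          = []
zigzag lo (suc zero)    = lo ∷ []
zigzag lo (suc (suc k)) = lo ∷ suc (lo + k) ∷ zigzag (suc lo) k

length-zigzag : ∀ lo len → length (zigzag lo len) ≡ len
length-zigzag lo zero          = refl
length-zigzag lo (suc zero)    = refl
length-zigzag lo (suc (suc k)) = cong (2 +_) (length-zigzag (suc lo) k)

zigzag-bounded : ∀ lo len → All (λ p → lo ≤ p × p < lo + len) (zigzag lo len)
zigzag-bounded lo zero          = []
zigzag-bounded lo (suc zero)    = (≤-refl , m<m+n lo z<s) ∷ []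
zigzag-bounded lo (suc (suc k)) =
  (≤-refl , m<m+n lo z<s) ∷ (m≤n⇒m≤1+n (m≤m+n lo k) , ≤-reflexive (sym lo+2+k)) ∷
  All.map widen (zigzag-bounded (suc lo) k)
  where
    lo+2+k : lo + suc (suc k) ≡ suc (suc (lo + k))
    lo+2+k = trans (+-suc lo (suc k)) (cong suc (+-suc lo k))
    widen : ∀ {p} → suc lo ≤ p × p < suc lo + k → lo ≤ p × p < lo + suc (suc k)
    widen (lo<p , p<) = ≤-trans (n≤1+n lo) lo<p , <-trans p< (subst (suc lo + k <_) (sym lo+2+k) (n<1+n _))

zigzag-complete : ∀ lo len i → i < len → lo + i ∈ zigzag lo len
zigzag-complete lo (suc zero)    zero    _ = here (+-identityʳ lo)
zigzag-complete lo (suc zero)    (suc i) (s≤s ())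
zigzag-complete lo (suc (suc k)) zero    _ = here (+-identityʳ lo)
zigzag-complete lo (suc (suc k)) (suc i) (s≤s (s≤s i≤k)) with m≤n⇒m<n∨m≡n i≤k
... | inj₁ i<k  = there (there (subst (_∈ zigzag (suc lo) k) (sym (+-suc lo i)) (zigzag-complete (suc lo) k i i<k)))
... | inj₂ refl = there (here (+-suc lo i))

zigzag-covers : ∀ lo len {p} → lo ≤ p → p < lo + len → p ∈ zigzag lo len
zigzag-covers lo len {p} lo≤p p<lo+len = subst (_∈ zigzag lo len) (m+[n∸m]≡n lo≤p)
  (zigzag-complete lo len (p ∸ lo) (+-cancelˡ-< lo _ _ (subst (_< lo + len) (sym (m+[n∸m]≡n lo≤p)) p<lo+len)))

path-∷-zigzag : ∀ {g : ℕ → ℕ} {x ex} lo m → g x ≡ lo → Path g (zigzag lo (suc m)) ex →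
  Path g (x ∷ zigzag lo (suc m)) ex
path-∷-zigzag lo zero    gx≡lo p = gx≡lo , p
path-∷-zigzag lo (suc m) gx≡lo p = gx≡lo , p

block-path : ∀ (g : ℕ → ℕ) lo len ex → 1 ≤ len →
  (∀ i → i < len → g (lo + i) ≡ nth (block lo len ex) i) → Path g (zigzag lo len) ex
block-path g lo (suc zero) ex _ g≡ = trans (cong g (sym (+-identityʳ lo))) (g≡ 0 z<s)
block-path g lo (suc (suc zero)) ex _ g≡ =
  trans (cong g (sym (+-identityʳ lo))) (trans (g≡ 0 z<s) (trans (+-identityʳ (lo + 1)) (+-suc lo 0))) ,
  trans (cong g (sym (+-suc lo 0))) (g≡ 1 (s<s z<s))
block-path g lo (suc (suc (suc k))) ex _ g≡ =
  trans (cong g (sym (+-identityʳ lo))) (trans (g≡ 0 z<s) (cong (λ w → nth w 0) unfold)) ,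
  path-∷-zigzag (suc lo) k
    (trans (cong g (sym (+-suc lo (suc k)))) (trans (g≡ (2 + k) ≤-refl)
      (trans (cong (λ w → nth w (2 + k)) unfold) last≡)))
    (block-path g (suc lo) (suc k) ex (s≤s z≤n) inner≡)
  where
    unfold = block-unfold lo k ex
    inner = block (suc lo) (suc k) ex
    last≡ : nth (inner ++ suc lo ∷ []) (suc k) ≡ suc lo
    last≡ = subst (λ z → nth (inner ++ suc lo ∷ []) z ≡ suc lo)
              (trans (+-identityʳ _) (length-block (suc lo) (suc k) ex)) (nth-++ʳ inner (suc lo ∷ []) 0)
    inner≡ : ∀ i → i < suc k → g (suc lo + i) ≡ nth inner i
    inner≡ i i<k = trans (cong g (sym (+-suc lo i))) (trans (g≡ (suc i) (s<s (m≤n⇒m≤1+n i<k)))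
      (trans (cong (λ w → nth w (suc i)) unfold)
             (nth-++ˡ inner (suc lo ∷ []) (subst (i <_) (sym (length-block (suc lo) (suc k) ex)) i<k))))

-- The construction

-- The word init ++ [y] is the one-line notation of a permutation of 1, …, n whose cycle
-- through 1 is before ++ n ∷ after; ℓ is the length of the last column added.
record Stage : Set where
  constructor stage
  field
    n      : ℕ
    init   : List ℕ
    y      : ℕ
    before : List ℕ
    after  : List ℕ
    ℓ      : ℕ

wordOf : Stage → List ℕ
wordOf S = Stage.init S ++ Stage.y S ∷ []

cycleOf : Stage → List ℕ
cycleOf S = Stage.before S ++ Stage.n S ∷ Stage.after S

-- The last letter after adding a column of length c to n letters ending in y: it sends the
-- new maximum n + c to the start n + 1 of the column's zigzag, or straight to y if c = 1.
newLast : ℕ → ℕ → ℕ → ℕ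
newLast (suc (suc _)) n y = suc n
newLast _             n y = y

first : ℕ → ℕ → Stage
first c₁ c₂ = stage (c₁ + c₂) (block 1 c₁ (c₁ + c₂) ++ block (suc c₁) (c₂ ∸ 1) 1) (newLast c₂ c₁ 1)
                    (zigzag 1 c₁) (zigzag (suc c₁) (c₂ ∸ 1)) c₂

add : ℕ → Stage → Stage
add c (stage n init y before after ℓ) =
  stage (n + c) (init ++ (n + c) ∷ block (suc n) (c ∸ 1) y) (newLast c n y)
        (before ++ n ∷ []) (zigzag (suc n) (c ∸ 1) ++ after) c

addAll : List ℕ → Stage → Stage
addAll []       S = S
addAll (c ∷ cs) S = addAll cs (add c S)

wordFun-++ˡ : ∀ pre X p → 1 ≤ p → p ≤ length pre → wordFun (pre ++ X) p ≡ wordFun pre p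
wordFun-++ˡ pre X (suc p) _ p<∣pre∣ = nth-++ˡ pre X p<∣pre∣

wordFun-++ʳ : ∀ pre X i → wordFun (pre ++ X) (suc (length pre + i)) ≡ nth X i
wordFun-++ʳ pre X i = nth-++ʳ pre X i

module _ (pre : List ℕ) (y c₀ : ℕ) where
  private
    m  = length pre
    y′ = newLast (suc c₀) m y
    X  = block (suc m) c₀ y ++ y′ ∷ []

  detour-on-block : ∀ i → i < c₀ → wordFun (pre ++ X) (suc m + i) ≡ nth (block (suc m) c₀ y) i
  detour-on-block i i<c₀ =
    trans (wordFun-++ʳ pre X i) (nth-++ˡ (block (suc m) c₀ y) _ (subst (i <_) (sym (length-block (suc m) c₀ y)) i<c₀))

  detour-last : wordFun (pre ++ X) (m + suc c₀) ≡ y′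
  detour-last = begin
      wordFun (pre ++ X) (m + suc c₀)    ≡⟨ cong (wordFun (pre ++ X)) (+-suc m c₀) ⟩
      wordFun (pre ++ X) (suc (m + c₀))  ≡⟨ wordFun-++ʳ pre X c₀ ⟩
      nth X c₀                           ≡⟨ cong (nth X) (sym (trans (+-identityʳ _) (length-block _ c₀ y))) ⟩
      nth X (length (block (suc m) c₀ y) + 0) ≡⟨ nth-++ʳ (block (suc m) c₀ y) (y′ ∷ []) 0 ⟩
      y′                                 ∎

detour-path : ∀ pre m y c₀ → length pre ≡ m →
  Path (wordFun (pre ++ block (suc m) c₀ y ++ newLast (suc c₀) m y ∷ [])) ((m + suc c₀) ∷ zigzag (suc m) c₀) y
detour-path pre _ y zero     refl = detour-last pre y zero
detour-path pre _ y (suc c₁) refl = path-∷-zigzag (suc (length pre)) c₁ (detour-last pre y (suc c₁))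
  (block-path _ (suc (length pre)) (suc c₁) y (s≤s z≤n) (detour-on-block pre y (suc c₁)))

record CycleInvariant (S : Stage) : Set where
  open Stage S
  field
    length-init  : suc (length init) ≡ n
    length-cycle : length (cycleOf S) ≡ n
    starts-at-1  : ∃ λ t → before ≡ 1 ∷ t
    closed       : Path (wordFun (wordOf S)) (cycleOf S) 1
    covers       : ∀ p → 1 ≤ p → p ≤ n → p ∈ cycleOf S
    bounded      : All (λ p → 1 ≤ p × p < n) (before ++ after)

length-insert : ∀ (A : List ℕ) a X B → length (A ++ a ∷ X ++ B) ≡ length (A ++ a ∷ B) + length X
length-insert A a X B rewrite length-++ A {a ∷ X ++ B} | length-++ A {a ∷ B} | length-++ X {B} =
  trans (cong (λ z → length A + suc z) (+-comm (length X) (length B))) (sym (+-assoc (length A) _ (length X)))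

covers-add : ∀ n c₀ before after → (∀ p → 1 ≤ p → p ≤ n → p ∈ before ++ n ∷ after) →
  ∀ p → 1 ≤ p → p ≤ n + suc c₀ → p ∈ (before ++ n ∷ []) ++ (n + suc c₀) ∷ (zigzag (suc n) c₀ ++ after)
covers-add n c₀ before after covers p 1≤p p≤ with ≤-<-connex p n
... | inj₁ p≤n with ∈-++⁻ before (covers p 1≤p p≤n)
...   | inj₁ p∈before       = ∈-++⁺ˡ (∈-++⁺ˡ p∈before)
...   | inj₂ (here p≡n)     = ∈-++⁺ˡ (∈-++⁺ʳ before (here p≡n))
...   | inj₂ (there p∈after) = ∈-++⁺ʳ (before ++ n ∷ []) (there (∈-++⁺ʳ (zigzag (suc n) c₀) p∈after))
covers-add n c₀ before after covers p 1≤p p≤ | inj₂ n<p with m≤n⇒m<n∨m≡n p≤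
... | inj₂ p≡top = ∈-++⁺ʳ (before ++ n ∷ []) (here p≡top)
... | inj₁ p<top = ∈-++⁺ʳ (before ++ n ∷ []) (there (∈-++⁺ˡ
      (zigzag-covers (suc n) c₀ n<p (subst (p <_) (+-suc n c₀) p<top))))

bounded-add : ∀ n c₀ before after → 1 ≤ n → All (λ p → 1 ≤ p × p < n) (before ++ after) →
  All (λ p → 1 ≤ p × p < n + suc c₀) ((before ++ n ∷ []) ++ zigzag (suc n) c₀ ++ after)
bounded-add n c₀ before after 1≤n bounded =
  All.++⁺ (All.++⁺ (All.map widen (All.++⁻ˡ before bounded)) ((1≤n , m<m+n n z<s) ∷ []))
          (All.++⁺ (All.map (λ (n<p , p<) → ≤-trans 1≤n (<⇒≤ n<p) , ≤-trans p< (≤-reflexive (sym (+-suc n c₀))))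
                            (zigzag-bounded (suc n) c₀))
                   (All.map widen (All.++⁻ʳ before bounded)))
  where
    widen : ∀ {p} → 1 ≤ p × p < n → 1 ≤ p × p < n + suc c₀
    widen (1≤p , p<n) = 1≤p , <-≤-trans p<n (m≤m+n n _)

first-cycle : ∀ c₁ c₂ → 2 ≤ c₁ → 1 ≤ c₂ → CycleInvariant (first c₁ c₂)
first-cycle (suc zero) _ (s≤s ()) _
first-cycle c₁@(suc (suc l)) c₂@(suc c₀) _ _ = record
  { length-init  = trans (cong suc (trans (length-++ b₁)
                                       (cong₂ _+_ (length-block 1 c₁ n) (length-block (suc c₁) c₀ 1))))
                         (sym (+-suc c₁ c₀))
  ; length-cycle = trans (length-++ (zigzag 1 c₁))
                         (cong₂ (λ a b → a + suc b) (length-zigzag 1 c₁) (length-zigzag (suc c₁) c₀))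
  ; starts-at-1  = _ , refl
  ; closed       = path-++ (zigzag 1 c₁) first-block second-block
  ; covers       = covers
  ; bounded      = All.++⁺ (All.map (λ (1≤p , p<) → 1≤p , ≤-trans p< c₁<n) (zigzag-bounded 1 c₁))
                           (All.map (λ (c₁<p , p<) → ≤-trans (s≤s z≤n) c₁<p ,
                                                      ≤-trans p< (≤-reflexive (sym (+-suc c₁ c₀))))
                                    (zigzag-bounded (suc c₁) c₀))
  }
  where
    n  = c₁ + c₂
    b₁ = block 1 c₁ n
    y  = newLast c₂ c₁ 1
    W≡ : wordOf (first c₁ c₂) ≡ b₁ ++ block (suc c₁) c₀ 1 ++ y ∷ []
    W≡ = ++-assoc b₁ _ (y ∷ [])
    g = wordFun (wordOf (first c₁ c₂))
    c₁<n : suc c₁ ≤ n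
    c₁<n = subst (suc c₁ ≤_) (sym (+-suc c₁ c₀)) (s≤s (m≤m+n c₁ c₀))
    first-block : Path g (zigzag 1 c₁) n
    first-block = block-path g 1 c₁ n (s≤s z≤n) λ i i<c₁ →
      trans (cong (λ W → nth W i) W≡) (nth-++ˡ b₁ _ (subst (i <_) (sym (length-block 1 c₁ n)) i<c₁))
    second-block : Path g (n ∷ zigzag (suc c₁) c₀) 1
    second-block = subst (λ W → Path (wordFun W) (n ∷ zigzag (suc c₁) c₀) 1) (sym W≡)
      (detour-path b₁ c₁ 1 c₀ (length-block 1 c₁ n))
    covers : ∀ p → 1 ≤ p → p ≤ n → p ∈ zigzag 1 c₁ ++ n ∷ zigzag (suc c₁) c₀
    covers p 1≤p p≤n with ≤-<-connex p c₁
    ... | inj₁ p≤c₁ = ∈-++⁺ˡ (zigzag-covers 1 c₁ 1≤p (s≤s p≤c₁))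
    ... | inj₂ c₁<p with m≤n⇒m<n∨m≡n p≤n
    ...   | inj₂ p≡n = ∈-++⁺ʳ (zigzag 1 c₁) (here p≡n)
    ...   | inj₁ p<n = ∈-++⁺ʳ (zigzag 1 c₁) (there (zigzag-covers (suc c₁) c₀ c₁<p (subst (p <_) (+-suc c₁ c₀) p<n)))

wordFun-prefix : ∀ pre X Y p → 1 ≤ p → p ≤ length pre → wordFun (pre ++ X) p ≡ wordFun (pre ++ Y) p
wordFun-prefix pre X Y p 1≤p p≤ = trans (wordFun-++ˡ pre X p 1≤p p≤) (sym (wordFun-++ˡ pre Y p 1≤p p≤))

-- The edge n ↦ y of the cycle is replaced by n ↦ n + c ↦ (zigzag of the new column) ↦ y.
add-cycle : ∀ c S → 1 ≤ c → CycleInvariant S → CycleInvariant (add c S)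
add-cycle (suc c₀) (stage n init y before after ℓ) _ inv with CycleInvariant.length-init inv
... | refl = record
  { length-init  = cong suc (trans (length-++ init) (cong (λ z → length init + suc z) (length-block (suc n) c₀ y)))
  ; length-cycle = trans (cong length cycle≡) (trans (length-insert before n ((n + c) ∷ zigzag (suc n) c₀) after)
                         (cong₂ _+_ length-cycle (cong suc (length-zigzag (suc n) c₀))))
  ; starts-at-1  = let (t , eq) = starts-at-1 in t ++ n ∷ [] , cong (_++ n ∷ []) eq
  ; closed       = subst (λ L → Path g′ L 1) (sym cycle≡)
                     (path-splice before n (zigzag (suc n) c₀) after closed agree g′n≡
                       (subst (Path g′ ((n + c) ∷ zigzag (suc n) c₀)) (sym gn≡) detour))
  ; covers       = covers-add n c₀ before after covers
  ; bounded      = bounded-add n c₀ before after (s≤s z≤n) bounded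
  }
  where
    open CycleInvariant inv
    c = suc c₀
    S = stage n init y before after ℓ
    rest = block (suc n) c₀ y ++ newLast c n y ∷ []
    W′≡ : wordOf (add c S) ≡ init ++ (n + c) ∷ rest
    W′≡ = ++-assoc init ((n + c) ∷ block (suc n) c₀ y) (newLast c n y ∷ [])
    g  = wordFun (wordOf S)
    g′ = wordFun (wordOf (add c S))
    cycle≡ : cycleOf (add c S) ≡ before ++ n ∷ ((n + c) ∷ zigzag (suc n) c₀) ++ after
    cycle≡ = ++-assoc before (n ∷ []) ((n + c) ∷ zigzag (suc n) c₀ ++ after)
    agree : All (λ p → g′ p ≡ g p) (before ++ after)
    agree = All.map (λ {p} (1≤p , p<n) → trans (cong (λ W → wordFun W p) W′≡)
                                               (wordFun-prefix init _ (y ∷ []) p 1≤p (≤-pred p<n))) bounded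
    g′n≡ : g′ n ≡ n + c
    g′n≡ = trans (cong (λ W → wordFun W n) W′≡)
                 (trans (cong (wordFun (init ++ (n + c) ∷ rest)) (cong suc (sym (+-identityʳ (length init)))))
                        (wordFun-++ʳ init ((n + c) ∷ rest) 0))
    gn≡ : g n ≡ y
    gn≡ = trans (cong (wordFun (init ++ y ∷ [])) (cong suc (sym (+-identityʳ (length init)))))
                (wordFun-++ʳ init (y ∷ []) 0)
    detour : Path g′ ((n + c) ∷ zigzag (suc n) c₀) y
    detour = subst (λ W → Path (wordFun W) ((n + c) ∷ zigzag (suc n) c₀) y)
      (trans (++-assoc init (n + c ∷ []) rest) (sym W′≡))
      (detour-path (init ++ n + c ∷ []) n y c₀ (trans (length-++ init) (+-comm (length init) 1)))

addAll-cycle : ∀ cs S → All (1 ≤_) cs → CycleInvariant S → CycleInvariant (addAll cs S)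
addAll-cycle []       S []           inv = inv
addAll-cycle (c ∷ cs) S (1≤c ∷ 1≤cs) inv = addAll-cycle cs (add c S) 1≤cs (add-cycle c S 1≤c inv)

cyclic-permutation : ∀ S → CycleInvariant S →
  Σ (Permutation′ (length (wordOf S))) λ σ → IsCyclic σ × oneLine σ ≡ wordOf S
cyclic-permutation S inv =
  cycle⇒cyclic-permutation (wordOf S) (cycleOf S) (trans length-cycle (sym ∣W∣≡n)) closed′
    (λ p 1≤p p≤ → covers p 1≤p (subst (p ≤_) ∣W∣≡n p≤)) bounded′
  where
    open Stage S
    open CycleInvariant inv
    ∣W∣≡n : length (wordOf S) ≡ n
    ∣W∣≡n = trans (length-++ init) (trans (+-comm _ 1) length-init)
    closed′ : Path (wordFun (wordOf S)) (cycleOf S) (nth (cycleOf S) 0)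
    closed′ = subst (Path _ (cycleOf S)) (sym (cong (λ b → nth (b ++ n ∷ after) 0) (proj₂ starts-at-1))) closed
    bounded′ : All (λ p → 1 ≤ p × p ≤ length (wordOf S)) (cycleOf S)
    bounded′ = subst (λ m → All (λ p → 1 ≤ p × p ≤ m) (cycleOf S)) (sym ∣W∣≡n)
      (All.++⁺ (All.map widen (All.++⁻ˡ before bounded))
               ((subst (1 ≤_) length-init (s≤s z≤n) , ≤-refl) ∷ All.map widen (All.++⁻ʳ before bounded)))
      where
        widen : ∀ {p} → 1 ≤ p × p < n → 1 ≤ p × p ≤ n
        widen (1≤p , p<n) = 1≤p , <⇒≤ p<n

-- P(init) is the tableau with columns cols, except that y is still missing from the top of
-- its column; all columns to its right have length one.
record TableauInvariant (S : Stage) (cols : List ℕ) : Set where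
  open Stage S
  field
    left     : List Column
    k        : ℕ
    right    : List Column
    P-init   : P init ≡ columnTableau (left ++ (suc y , k) ∷ right)
    shape    : map proj₂ (left ++ (y , suc k) ∷ right) ≡ cols
    left-ok  : All (LeftOf y k) left
    right-ok : All (λ c → proj₁ c ≤ n × proj₂ c ≡ 1) right
    1≤k      : 1 ≤ k
    y<n      : y < n
    last     : (right ≡ [] × ℓ ≡ suc k) ⊎ ℓ ≡ 1

P-snoc : ∀ w a → P (w ++ a ∷ []) ≡ insertT a (P w)
P-snoc w a = insertAll-++ [] w (a ∷ [])

shape-word : ∀ S cols → TableauInvariant S cols → Γ (P (wordOf S)) ≡ conjugate cols
shape-word S cols inv = begin
    Γ (P (init ++ y ∷ []))
  ≡⟨ cong Γ (P-snoc init y) ⟩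
    Γ (insertT y (P init))
  ≡⟨ cong (λ T → Γ (insertT y T)) P-init ⟩
    Γ (insertT y (columnTableau (left ++ (suc y , k) ∷ right)))
  ≡⟨ cong Γ (insertT-extend-column y k left right left-ok (right-short right right-ok)) ⟩
    Γ (columnTableau (left ++ (y , suc k) ∷ right))
  ≡⟨ Γ-columnTableau (left ++ (y , suc k) ∷ right) ⟩
    conjugate (map proj₂ (left ++ (y , suc k) ∷ right))
  ≡⟨ cong conjugate shape ⟩
    conjugate cols
  ∎
  where
    open Stage S
    open TableauInvariant inv
    right-short : ∀ ds → All (λ c → proj₁ c ≤ n × proj₂ c ≡ 1) ds → height ds ≤ k
    right-short []       _              = z≤n
    right-short (d ∷ ds) ((_ , ≡1) ∷ _) = subst (_≤ k) (sym ≡1) 1≤k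

add-single-shape : ∀ S cols → TableauInvariant S cols → TableauInvariant (add 1 S) (cols ++ 1 ∷ [])
add-single-shape (stage n init y before after ℓ) cols inv = record
  { left     = left
  ; k        = k
  ; right    = right ++ (n + 1 , 1) ∷ []
  ; P-init   = begin
      P (init ++ n + 1 ∷ [])
    ≡⟨ P-snoc init (n + 1) ⟩
      insertT (n + 1) (P init)
    ≡⟨ cong (insertT (n + 1)) P-init ⟩
      insertT (n + 1) (columnTableau (left ++ (suc y , k) ∷ right))
    ≡⟨ insertT-new-column (n + 1) _ below ⟩
      columnTableau ((left ++ (suc y , k) ∷ right) ++ (n + 1 , 1) ∷ [])
    ≡⟨ cong columnTableau (++-assoc left ((suc y , k) ∷ right) _) ⟩
      columnTableau (left ++ (suc y , k) ∷ right ++ (n + 1 , 1) ∷ [])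
    ∎
  ; shape    = trans (cong (map proj₂) (sym (++-assoc left ((y , suc k) ∷ right) _)))
                     (trans (map-++ proj₂ (left ++ (y , suc k) ∷ right) _) (cong (_++ 1 ∷ []) shape))
  ; left-ok  = left-ok
  ; right-ok = All.++⁺ (All.map (λ (t≤n , ≡1) → widen t≤n , ≡1) right-ok) ((≤-refl , refl) ∷ [])
  ; 1≤k      = 1≤k
  ; y<n      = widen y<n
  ; last     = inj₂ refl
  }
  where
    open TableauInvariant inv
    widen : ∀ {a} → a ≤ n → a ≤ n + 1
    widen a≤n = ≤-trans a≤n (m≤m+n n 1)
    below : All (LeftOf (n + 1) 0) (left ++ (suc y , k) ∷ right)
    below = All.++⁺ (All.map (λ (t≤y , k<) → widen (≤-trans t≤y (<⇒≤ y<n)) , <-≤-trans (s≤s z≤n) k<) left-ok)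
                    ((widen y<n , 1≤k) ∷ All.map (λ (t≤n , ≡1) → widen t≤n , ≤-reflexive (sym ≡1)) right-ok)

add-long-shape : ∀ c′ S cols → 2 + c′ ≤ Stage.ℓ S → TableauInvariant S cols →
  TableauInvariant (add (2 + c′) S) (cols ++ 2 + c′ ∷ [])
add-long-shape c′ (stage n init y before after ℓ) cols c≤ℓ inv with TableauInvariant.last inv
... | inj₂ refl = ⊥-elim (<⇒≱ (s≤s (s≤s z≤n)) c≤ℓ)
... | inj₁ (refl , refl) = record
  { left     = left ++ (y , suc k) ∷ []
  ; k        = suc c′
  ; right    = []
  ; P-init   = begin
      P (init ++ top ∷ block (suc n) (suc c′) y)
    ≡⟨ insertAll-++ [] init (top ∷ block (suc n) (suc c′) y) ⟩
      insertAll (insertT top (P init)) (block (suc n) (suc c′) y)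
    ≡⟨ cong (λ T → insertAll (insertT top T) (block (suc n) (suc c′) y)) P-init ⟩
      insertAll (insertT top (columnTableau (left ++ (suc y , k) ∷ []))) (block (suc n) (suc c′) y)
    ≡⟨ cong (λ T → insertAll T (block (suc n) (suc c′) y)) (insertT-new-column top _ below) ⟩
      insertAll (columnTableau ((left ++ (suc y , k) ∷ []) ++ (top , 1) ∷ [])) (block (suc n) (suc c′) y)
    ≡⟨ cong (λ cs → insertAll (columnTableau cs) (block (suc n) (suc c′) y))
            (trans (++-assoc left _ _) (cong (λ t → left ++ (suc y , k) ∷ (t , 1) ∷ []) (+-suc n (suc c′)))) ⟩
      insertAll (columnTableau (left ++ (suc y , k) ∷ (suc n + suc c′ , 1) ∷ [])) (block (suc n) (suc c′) y)
    ≡⟨ insertAll-block (suc n) (suc c′) y k left (s≤s z≤n) c′<k (m≤n⇒m≤1+n y<n) left-ok ⟩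
      columnTableau (left ++ (y , suc k) ∷ (suc (suc n) , suc c′) ∷ [])
    ≡⟨ cong columnTableau (sym (++-assoc left _ _)) ⟩
      columnTableau ((left ++ (y , suc k) ∷ []) ++ (suc (suc n) , suc c′) ∷ [])
    ∎
  ; shape    = trans (map-++ proj₂ (left ++ (y , suc k) ∷ []) _) (cong (_++ 2 + c′ ∷ []) shape)
  ; left-ok  = All.++⁺ (All.map (λ (t≤y , k<) → ≤-trans t≤y y≤n+1 , ≤-<-trans c′<k k<) left-ok)
                       ((y≤n+1 , s≤s c′<k) ∷ [])
  ; right-ok = []
  ; 1≤k      = s≤s z≤n
  ; y<n      = subst (suc n <_) (sym (+-suc n (suc c′))) (s≤s (m<m+n n z<s))
  ; last     = inj₁ (refl , refl)
  }
  where
    open TableauInvariant inv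
    top = n + (2 + c′)
    c′<k : suc c′ ≤ k
    c′<k = ≤-pred c≤ℓ
    y≤n+1 : y ≤ suc n
    y≤n+1 = ≤-trans (<⇒≤ y<n) (n≤1+n n)
    below : All (LeftOf top 0) (left ++ (suc y , k) ∷ [])
    below = All.++⁺ (All.map (λ (t≤y , k<) → ≤-trans t≤y (≤-trans (<⇒≤ y<n) n≤top) , <-≤-trans (s≤s z≤n) k<) left-ok)
                    ((≤-trans y<n n≤top , 1≤k) ∷ [])
      where
        n≤top : n ≤ top
        n≤top = m≤m+n n _

add-shape : ∀ c S cols → 1 ≤ c → c ≤ Stage.ℓ S → TableauInvariant S cols →
  TableauInvariant (add c S) (cols ++ c ∷ [])
add-shape 1              S cols _ _   inv = add-single-shape S cols inv
add-shape (suc (suc c′)) S cols _ c≤ℓ inv = add-long-shape c′ S cols c≤ℓ inv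

addAll-shape : ∀ cs S cols → All (1 ≤_) cs → Linked _≥_ (Stage.ℓ S ∷ cs) → TableauInvariant S cols →
  TableauInvariant (addAll cs S) (cols ++ cs)
addAll-shape []       S cols _            _            inv = subst (TableauInvariant S) (sym (++-identityʳ cols)) inv
addAll-shape (c ∷ cs) S cols (1≤c ∷ 1≤cs) (c≤ℓ ∷ chain) inv =
  subst (TableauInvariant (addAll cs (add c S))) (++-assoc cols (c ∷ []) cs)
    (addAll-shape cs (add c S) (cols ++ c ∷ []) 1≤cs chain (add-shape c S cols 1≤c c≤ℓ inv))

first-shape : ∀ c₁ c₂ → 2 ≤ c₁ → 1 ≤ c₂ → c₂ ≤ c₁ → TableauInvariant (first c₁ c₂) (c₁ ∷ c₂ ∷ [])
first-shape (suc zero) _ (s≤s ()) _ _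
first-shape c₁@(suc (suc l)) 1 _ _ _ = record
  { left     = []
  ; k        = suc l
  ; right    = (c₁ + 1 , 1) ∷ []
  ; P-init   = trans (cong P (++-identityʳ (block 1 c₁ (c₁ + 1))))
                     (insertAll-first-block l (c₁ + 1) (m<m+n c₁ z<s))
  ; shape    = refl
  ; left-ok  = []
  ; right-ok = (≤-refl , refl) ∷ []
  ; 1≤k      = s≤s z≤n
  ; y<n      = s≤s (s≤s z≤n)
  ; last     = inj₂ refl
  }
first-shape c₁@(suc (suc l)) c₂@(suc (suc c′)) _ _ c₂≤c₁ = record
  { left     = (1 , c₁) ∷ []
  ; k        = suc c′
  ; right    = []
  ; P-init   = begin
      P (block 1 c₁ n ++ block (suc c₁) (suc c′) 1)
    ≡⟨ insertAll-++ [] (block 1 c₁ n) _ ⟩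
      insertAll (P (block 1 c₁ n)) (block (suc c₁) (suc c′) 1)
    ≡⟨ cong (λ T → insertAll T (block (suc c₁) (suc c′) 1)) (insertAll-first-block l n c₁<n) ⟩
      insertAll (columnTableau ((2 , suc l) ∷ (n , 1) ∷ [])) (block (suc c₁) (suc c′) 1)
    ≡⟨ cong (λ t → insertAll (columnTableau ((2 , suc l) ∷ (t , 1) ∷ [])) (block (suc c₁) (suc c′) 1))
            (+-suc c₁ (suc c′)) ⟩
      insertAll (columnTableau ([] ++ (2 , suc l) ∷ (suc c₁ + suc c′ , 1) ∷ [])) (block (suc c₁) (suc c′) 1)
    ≡⟨ insertAll-block (suc c₁) (suc c′) 1 (suc l) [] (s≤s z≤n) (≤-pred c₂≤c₁) (s≤s (s≤s z≤n)) [] ⟩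
      columnTableau ((1 , c₁) ∷ (suc (suc c₁) , suc c′) ∷ [])
    ∎
  ; shape    = refl
  ; left-ok  = (s≤s z≤n , c₂≤c₁) ∷ []
  ; right-ok = []
  ; 1≤k      = s≤s z≤n
  ; y<n      = subst (suc (suc c₁) ≤_) (sym (trans (+-suc c₁ _) (cong suc (+-suc c₁ c′)))) (s≤s (s≤s (m≤m+n c₁ c′)))
  ; last     = inj₁ (refl , refl)
  }
  where
    n = c₁ + c₂
    c₁<n : c₁ < n
    c₁<n = m<m+n c₁ z<s

word : ℕ → ℕ → List ℕ → List ℕ
word c₁ c₂ cs = wordOf (addAll cs (first c₁ c₂))

Γ-P-word : ∀ c₁ c₂ cs → 2 ≤ c₁ → All (1 ≤_) (c₂ ∷ cs) → Linked _≥_ (c₁ ∷ c₂ ∷ cs) →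
  Γ (P (word c₁ c₂ cs)) ≡ conjugate (c₁ ∷ c₂ ∷ cs)
Γ-P-word c₁ c₂ cs 2≤c₁ (1≤c₂ ∷ 1≤cs) (c₂≤c₁ ∷ chain) = shape-word _ _
  (addAll-shape cs (first c₁ c₂) (c₁ ∷ c₂ ∷ []) 1≤cs chain (first-shape c₁ c₂ 2≤c₁ 1≤c₂ c₂≤c₁))

word-cyclic : ∀ c₁ c₂ cs → 2 ≤ c₁ → All (1 ≤_) (c₂ ∷ cs) →
  Σ (Permutation′ (length (word c₁ c₂ cs))) λ σ → IsCyclic σ × oneLine σ ≡ word c₁ c₂ cs
word-cyclic c₁ c₂ cs 2≤c₁ (1≤c₂ ∷ 1≤cs) =
  cyclic-permutation _ (addAll-cycle cs (first c₁ c₂) 1≤cs (first-cycle c₁ c₂ 2≤c₁ 1≤c₂))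

ones-replicate : ∀ ks → All (1 ≤_) ks → Linked _≥_ (1 ∷ ks) → ks ≡ replicate (sum ks) 1
ones-replicate []       _            _          = refl
ones-replicate (k ∷ ks) (1≤k ∷ 1≤ks) (k≤1 ∷ ls) with ≤-antisym k≤1 1≤k
... | refl = cong (1 ∷_) (ones-replicate ks 1≤ks ls)

conjugate-proper : ∀ {n} lam → IsPartition n lam → lam ≢ n ∷ [] → lam ≢ replicate n 1 →
  ∃ λ c₁ → ∃ λ c₂ → ∃ λ cs → conjugate lam ≡ c₁ ∷ c₂ ∷ cs × 2 ≤ c₁
conjugate-proper []      (_ , _ , refl) _ lam≢1ⁿ = ⊥-elim (lam≢1ⁿ refl)
conjugate-proper (a ∷ []) (_ , _ , Σ≡n) lam≢n _ = ⊥-elim (lam≢n (cong (_∷ []) (trans (sym (+-identityʳ a)) Σ≡n)))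
conjugate-proper (zero ∷ _ ∷ _) (() ∷ _ , _) _ _
conjugate-proper lam@(1 ∷ _ ∷ _) (pos , dec , refl) _ lam≢1ⁿ = ⊥-elim (lam≢1ⁿ (ones-replicate lam pos (≤-refl ∷ dec)))
conjugate-proper lam@(suc (suc _) ∷ _ ∷ _) (pos , _) _ _ =
  _ , _ , _ , refl , subst (2 ≤_) (sym (leadingAbove-0 lam pos)) (s≤s (s≤s z≤n))

theorem3p1 : (n : ℕ) → n ≥ 1 → (lam : List ℕ) → IsPartition n lam →
    lam ≢ n ∷ [] → lam ≢ replicate n 1 →
    Σ (Permutation′ n) (λ σ → IsCyclic σ × Γ (P (oneLine σ)) ≡ lam)
theorem3p1 n _ lam part@(pos , dec , Σ≡n) lam≢n lam≢1ⁿ with conjugate-proper lam part lam≢n lam≢1ⁿ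
... | c₁ , c₂ , cs , conj≡ , 2≤c₁ =
  subst (λ m → Σ (Permutation′ m) (λ σ → IsCyclic σ × Γ (P (oneLine σ)) ≡ lam)) ∣W∣≡n
    (let (σ , cyclic , oneLine≡) = word-cyclic c₁ c₂ cs 2≤c₁ columns-positive
     in σ , cyclic , trans (cong (λ w → Γ (P w)) oneLine≡) shape)
  where
    W = word c₁ c₂ cs
    columns-positive : All (1 ≤_) (c₂ ∷ cs)
    columns-positive = All.tail (subst (All (1 ≤_)) conj≡ (conjugate-positive lam))
    shape : Γ (P W) ≡ lam
    shape = trans (Γ-P-word c₁ c₂ cs 2≤c₁ columns-positive (subst (Linked _≥_) conj≡ (conjugate-nonincreasing lam)))
                  (trans (cong conjugate (sym conj≡)) (conjugate-involutive lam pos dec))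
    ∣W∣≡n : length W ≡ n
    ∣W∣≡n = trans (sym (insertAll-size [] W)) (trans (cong sum shape) Σ≡n)
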